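{- Let $\mathbf{u}$ be either $\mathbf{r}$ or $\mathbf{s}$, let $t\geq 1$ be an integer and let $w$ be a subword of $\mathbf{u}$ with $|w|\leq 2^t+1$. Then $w$ is a subword of the prefix $p$ of $\mathbf{u}$ of length $7\cdot 2^{t+1}$. More precisely, if $w$ occurs in $\mathbf{u}$ at some position congruent to $c$ modulo $2^{t+1}$, then $w$ occurs in $p$ at a position congruent to $c$ modulo $2^{t+1}$.
   Context: $\mathbf{r}=(r_n)_{n\geq0}$ with $r_n=e_{11}(n)\bmod 2$, where $e_{11}(n)$ is the number of (possibly overlapping) occurrences of $11$ in the binary expansion of $n$; $\mathbf{s}=(s_n)_{n\geq0}$ with $s_n=r_{2n+1}$. The position of an occurrence $w=u_n u_{n+1}\cdots u_{n+|w|-1}$ of $w$ in $\mathbf{u}=(u_n)_{n\ge0}$ is $n$ (indices start at $0$). -}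

module Defs where

open import Data.Nat using (ℕ; zero; suc; _+_; _*_; _^_; _≤_; _<_)
open import Data.Nat.DivMod using (_/_; _%_)
open import Data.Bool using (Bool; true; false; if_then_else_)
open import Data.Nat using (_≡ᵇ_)
open import Data.Nat.Induction using (<-rec)
open import Data.List using (List; length; lookup)
open import Data.Fin using (Fin; toℕ)
open import Data.Product using (Σ; _×_)
open import Data.Sum using (_⊎_)
open import Relation.Binary.PropositionalEquality using (_≡_)

-- e₁₁(n) : number of (possibly overlapping) occurrences of 11 in the
-- binary expansion of n.  Recursion on the binary expansion: the last two
-- binary digits of n form 11 iff n % 4 = 3, and the remaining occurrences
-- lie in the binary expansion of ⌊n/2⌋.  Defined by fuel = n (since
-- ⌊n/2⌋ < n for n ≥ 1, fuel n suffices).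
e11-fuel : ℕ → ℕ → ℕ
e11-fuel zero    n = 0
e11-fuel (suc f) zero = 0
e11-fuel (suc f) n@(suc _) =
  (if (n % 4) ≡ᵇ 3 then 1 else 0) + e11-fuel f (n / 2)

e11 : ℕ → ℕ
e11 n = e11-fuel n n

odd : ℕ → Bool
odd n = (n % 2) ≡ᵇ 1

r : ℕ → Bool
r n = odd (e11 n)

s : ℕ → Bool
s n = r (2 * n + 1)

OccursAt : (ℕ → Bool) → List Bool → ℕ → Set
OccursAt u w i = (j : Fin (length w)) → lookup w j ≡ u (i + toℕ j)

open import Data.Nat using (NonZero)
open import Data.Nat.Properties using (m^n≢0)

_≡_[mod2^_] : ℕ → ℕ → ℕ → Set
a ≡ b [mod2^ e ] = (a % 2 ^ e) ≡ (b % 2 ^ e)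
  where instance _ : NonZero (2 ^ e)
                 _ = m^n≢0 2 e

-- Cut u into blocks of length 2^(t+1). Counting occurrences of 11 digit-wise shows that block q is
-- block 0 with each letter of its lower half flipped by r_q and each letter of its upper half
-- flipped by r_q ⊕ (q mod 2). A window of length at most 2^t + 1 that starts in the lower half
-- of a block q stays inside it, so it is determined by its offset and (r_q, q mod 2); one that
-- starts in the upper half lies in the upper half of block q and the lower half of block q + 1,
-- so it is determined by its offset and (r_q ⊕ (q mod 2), r_(q+1)). Every value of the first
-- pair is attained by some q ≤ 6 and every value of the second by some q ≤ 5, so the window
-- reappears at the same offset inside one of the first seven blocks.

module Submission where

open import Data.Bool using (Bool; true; false; not; _∧_; _xor_; if_then_else_)
open import Data.Bool.Properties using (not-involutive; xor-assoc; xor-identityʳ; ∧-zeroʳ; ∧-identityʳ)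
open import Data.Fin using (toℕ)
open import Data.Fin.Properties using (toℕ<n)
open import Data.List using (List; length)
open import Data.Nat using (ℕ; suc; zero; _+_; _*_; _^_; _∸_; _≤_; _<_; _≡ᵇ_; _≤?_; _<?_; NonZero; z≤n; s≤s; s≤s⁻¹)
open import Data.Nat.DivMod
open import Data.Nat.Divisibility using (_∣_; n∣m*n; m∣m*n; ∣n⇒∣m*n)
open import Data.Nat.Properties
open import Algebra.Properties.CommutativeSemigroup +-commutativeSemigroup using (xy∙z≈xz∙y)
open import Data.Nat.Tactic.RingSolver using (solve-∀)
open import Data.Product using (Σ; _×_; _,_)
open import Data.Sum using (_⊎_; inj₁; inj₂)
open import Function.Bundles using (mk⇔)
open import Relation.Binary.PropositionalEquality using (_≡_; refl; sym; trans; cong; cong₂; subst; module ≡-Reasoning)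
open import Relation.Nullary using (does; yes; no)
open import Relation.Nullary.Decidable using (does-⇔; dec-true; dec-false)

open import Defs

open ≡-Reasoning

[1+n]/2≤n : ∀ n → suc n / 2 ≤ n
[1+n]/2≤n n = <⇒≤pred (m/n<m (suc n) 2 (s≤s (s≤s z≤n)))

e11-fuel-irrelevant : ∀ f g n → n ≤ f → n ≤ g → e11-fuel f n ≡ e11-fuel g n
e11-fuel-irrelevant zero    zero    zero    _ _ = refl
e11-fuel-irrelevant zero    (suc g) zero    _ _ = refl
e11-fuel-irrelevant (suc f) zero    zero    _ _ = refl
e11-fuel-irrelevant (suc f) (suc g) zero    _ _ = refl
e11-fuel-irrelevant (suc f) (suc g) (suc n) (s≤s n≤f) (s≤s n≤g) =
  cong (_ +_) (e11-fuel-irrelevant f g (suc n / 2) (≤-trans ([1+n]/2≤n n) n≤f) (≤-trans ([1+n]/2≤n n) n≤g))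

ends-in-11 : ℕ → ℕ
ends-in-11 n = if n % 4 ≡ᵇ 3 then 1 else 0

e11-unfold : ∀ n → e11 (suc n) ≡ ends-in-11 (suc n) + e11 (suc n / 2)
e11-unfold n = cong (ends-in-11 (suc n) +_)
  (e11-fuel-irrelevant n (suc n / 2) (suc n / 2) ([1+n]/2≤n n) ≤-refl)

ends-in-11-double : ∀ n → ends-in-11 (n * 2) ≡ 0
ends-in-11-double n = begin
  ends-in-11 (n * 2)                      ≡⟨ cong (λ x → if x ≡ᵇ 3 then 1 else 0) (m%n*o≡m*o%[n*o] n 2 2) ⟨
  (if n % 2 * 2 ≡ᵇ 3 then 1 else 0)       ≡⟨ even (n % 2) ⟩
  0                                       ∎
  where
  even : ∀ x → (if x * 2 ≡ᵇ 3 then 1 else 0) ≡ 0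
  even zero          = refl
  even (suc zero)    = refl
  even (suc (suc x)) = refl

ends-in-11-double+1 : ∀ n → ends-in-11 (1 + n * 2) ≡ (if odd n then 1 else 0)
ends-in-11-double+1 n = begin
  ends-in-11 (1 + n * 2)                  ≡⟨ cong ends-in-11 (+-comm 1 (n * 2)) ⟩
  ends-in-11 (n * 2 + 1)                  ≡⟨ cong (λ x → if x ≡ᵇ 3 then 1 else 0) ([m*n+o]%[p*n]≡[m*n]%[p*n]+o n 2 (s≤s (s≤s z≤n))) ⟩
  (if n * 2 % 4 + 1 ≡ᵇ 3 then 1 else 0)   ≡⟨ cong (λ x → if x + 1 ≡ᵇ 3 then 1 else 0) (m%n*o≡m*o%[n*o] n 2 2) ⟨
  (if n % 2 * 2 + 1 ≡ᵇ 3 then 1 else 0)   ≡⟨ odd-digit (n % 2) ⟩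
  (if odd n then 1 else 0)                ∎
  where
  odd-digit : ∀ x → (if x * 2 + 1 ≡ᵇ 3 then 1 else 0) ≡ (if x ≡ᵇ 1 then 1 else 0)
  odd-digit zero          = refl
  odd-digit (suc zero)    = refl
  odd-digit (suc (suc x)) = refl

e11-double : ∀ n → e11 (n * 2) ≡ e11 n
e11-double zero        = refl
e11-double n@(suc n-1) = begin
  e11 (n * 2)                             ≡⟨ e11-unfold (suc (n-1 * 2)) ⟩
  ends-in-11 (n * 2) + e11 (n * 2 / 2)    ≡⟨ cong₂ _+_ (ends-in-11-double n) (cong e11 (m*n/n≡m n 2)) ⟩
  e11 n                                   ∎

e11-double+1 : ∀ n → e11 (1 + n * 2) ≡ (if odd n then 1 else 0) + e11 n
e11-double+1 n = begin
  e11 (1 + n * 2)                                 ≡⟨ e11-unfold (n * 2) ⟩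
  ends-in-11 (1 + n * 2) + e11 ((1 + n * 2) / 2)  ≡⟨ cong₂ _+_ (ends-in-11-double+1 n) (cong e11 half) ⟩
  (if odd n then 1 else 0) + e11 n                ∎
  where
  half : (1 + n * 2) / 2 ≡ n
  half = trans (+-distrib-/-∣ʳ 1 {d = 2} (n∣m*n n)) (m*n/n≡m n 2)

odd-2+ : ∀ n → odd (2 + n) ≡ odd n
odd-2+ n = cong (_≡ᵇ 1) (trans (cong (_% 2) (+-comm 2 n)) ([m+n]%n≡m%n n 2))

odd-suc : ∀ n → odd (suc n) ≡ not (odd n)
odd-suc zero    = refl
odd-suc (suc n) = trans (odd-2+ n) (sym (trans (cong not (odd-suc n)) (not-involutive (odd n))))

odd-+-even : ∀ m {n} → 2 ∣ n → odd (m + n) ≡ odd m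
odd-+-even m 2∣n = cong (_≡ᵇ 1) (%-remove-+ʳ m 2∣n)

odd-if+ : ∀ b n → odd ((if b then 1 else 0) + n) ≡ odd n xor b
odd-if+ false n = sym (xor-identityʳ (odd n))
odd-if+ true  n with odd n | odd-suc n
... | false | eq = eq
... | true  | eq = eq

r-double : ∀ n → r (2 * n) ≡ r n
r-double n = cong odd (trans (cong e11 (*-comm 2 n)) (e11-double n))

r-double+1 : ∀ n → r (1 + 2 * n) ≡ r n xor odd n
r-double+1 n = begin
  r (1 + 2 * n)                                  ≡⟨ cong (λ m → r (1 + m)) (*-comm 2 n) ⟩
  odd (e11 (1 + n * 2))                          ≡⟨ cong odd (e11-double+1 n) ⟩
  odd ((if odd n then 1 else 0) + e11 n)         ≡⟨ odd-if+ (odd n) (e11 n) ⟩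
  r n xor odd n                                  ∎

-- For j < 2 ^ suc t this is binary digit t of j.
high : ℕ → ℕ → Bool
high t j = does (2 ^ t ≤? j)

high-double : ∀ t j → high (suc t) (2 * j) ≡ high t j
high-double t j = does-⇔ (mk⇔ (*-cancelˡ-≤ 2) (*-monoʳ-≤ 2)) (2 ^ suc t ≤? 2 * j) (2 ^ t ≤? j)

high-double+1 : ∀ t j → high (suc t) (1 + 2 * j) ≡ high t j
high-double+1 t j = does-⇔ (mk⇔ to from) (2 ^ suc t ≤? 1 + 2 * j) (2 ^ t ≤? j)
  where
  to : 2 * 2 ^ t ≤ 1 + 2 * j → 2 ^ t ≤ j
  to le = *-cancelˡ-≤ 2 (s≤s⁻¹ (≤∧≢⇒< le (even≢odd (2 ^ t) j)))
  from : 2 ^ t ≤ j → 2 * 2 ^ t ≤ 1 + 2 * j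
  from le = m≤n⇒m≤1+n (*-monoʳ-≤ 2 le)

-- Cutting the binary expansion of j + q 2^(t+1) after digit t, the occurrences of 11
-- are those in q, those in j, and one more iff the last digit of q and digit t of j are 1.
Blockwise : (ℕ → Bool) → Set
Blockwise u = ∀ t q j → j < 2 ^ suc t → u (j + q * 2 ^ suc t) ≡ (r q xor (odd q ∧ high t j)) xor u j

data Halving : ℕ → Set where
  twice    : ∀ n → Halving (2 * n)
  twice+1  : ∀ n → Halving (1 + 2 * n)

halving : ∀ n → Halving n
halving zero = twice 0
halving (suc n) with halving n
... | twice m   = twice+1 m
... | twice+1 m = subst Halving (*-suc 2 m) (twice (suc m))

double-shift : ∀ j q P → 2 * j + q * (2 * P) ≡ 2 * (j + q * P)
double-shift = solve-∀

double+1-shift : ∀ j q P → 2 * (j + q * P) + 1 ≡ 1 + 2 * j + q * (2 * P)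
double+1-shift = solve-∀

r-blockwise : Blockwise r
r-blockwise zero q zero          _ = begin
  r (q * 2)                               ≡⟨ trans (cong r (*-comm q 2)) (r-double q) ⟩
  r q                                     ≡⟨ sym (trans (cong (λ b → (r q xor b) xor false) (∧-zeroʳ (odd q)))
                                                         (trans (xor-identityʳ _) (xor-identityʳ _))) ⟩
  (r q xor (odd q ∧ false)) xor false     ∎
r-blockwise zero q (suc zero)    _ = begin
  r (1 + q * 2)                           ≡⟨ trans (cong (λ m → r (1 + m)) (*-comm q 2)) (r-double+1 q) ⟩
  r q xor odd q                           ≡⟨ sym (trans (cong (λ b → (r q xor b) xor false) (∧-identityʳ (odd q)))
                                                         (xor-identityʳ _)) ⟩
  (r q xor (odd q ∧ true)) xor false      ∎
r-blockwise zero q (suc (suc j)) (s≤s (s≤s ()))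
r-blockwise (suc t) q j j<2P with halving j
... | twice j′ = begin
  r (2 * j′ + q * (2 * P))                ≡⟨ cong r (double-shift j′ q P) ⟩
  r (2 * (j′ + q * P))                    ≡⟨ r-double (j′ + q * P) ⟩
  r (j′ + q * P)                          ≡⟨ r-blockwise t q j′ (*-cancelˡ-< 2 j′ P j<2P) ⟩
  (r q xor (odd q ∧ high t j′)) xor r j′  ≡⟨ cong₂ (λ b c → (r q xor (odd q ∧ b)) xor c) (high-double t j′) (r-double j′) ⟨
  (r q xor (odd q ∧ high (suc t) (2 * j′))) xor r (2 * j′) ∎
  where P = 2 ^ suc t
... | twice+1 j′ = begin
  r (1 + 2 * j′ + q * (2 * P))                          ≡⟨ cong (λ m → r (1 + m)) (double-shift j′ q P) ⟩
  r (1 + 2 * (j′ + q * P))                              ≡⟨ r-double+1 (j′ + q * P) ⟩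
  r (j′ + q * P) xor odd (j′ + q * P)                   ≡⟨ cong₂ _xor_ (r-blockwise t q j′ j′<P) (odd-+-even j′ (∣n⇒∣m*n q (m∣m*n (2 ^ t)))) ⟩
  ((r q xor (odd q ∧ high t j′)) xor r j′) xor odd j′   ≡⟨ xor-assoc (r q xor (odd q ∧ high t j′)) (r j′) (odd j′) ⟩
  (r q xor (odd q ∧ high t j′)) xor (r j′ xor odd j′)   ≡⟨ cong₂ (λ b c → (r q xor (odd q ∧ b)) xor c) (high-double+1 t j′) (r-double+1 j′) ⟨
  (r q xor (odd q ∧ high (suc t) (1 + 2 * j′))) xor r (1 + 2 * j′) ∎
  where
  P = 2 ^ suc t
  j′<P : j′ < P
  j′<P = *-cancelˡ-< 2 j′ P (<-trans (n<1+n (2 * j′)) j<2P)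

s-blockwise : Blockwise s
s-blockwise t q j j<P = begin
  r (2 * (j + q * P) + 1)                            ≡⟨ cong r (double+1-shift j q P) ⟩
  r (1 + 2 * j + q * (2 * P))                        ≡⟨ r-blockwise (suc t) q (1 + 2 * j) (subst (_≤ 2 * P) (*-suc 2 j) (*-monoʳ-≤ 2 j<P)) ⟩
  (r q xor (odd q ∧ high (suc t) (1 + 2 * j))) xor r (1 + 2 * j) ≡⟨ cong₂ (λ b c → (r q xor (odd q ∧ b)) xor r c) (high-double+1 t j) (+-comm 1 (2 * j)) ⟩
  (r q xor (odd q ∧ high t j)) xor s j               ∎
  where P = 2 ^ suc t

occursAt-transfer : ∀ u w {i k} → OccursAt u w i →
  (∀ m → m < length w → u (i + m) ≡ u (k + m)) → OccursAt u w k
occursAt-transfer u w occ agree x = trans (occ x) (agree (toℕ x) (toℕ<n x))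

small-q-with-r-and-odd : ∀ q → Σ ℕ λ q′ → q′ ≤ 6 × r q ≡ r q′ × odd q ≡ odd q′
small-q-with-r-and-odd q with r q | odd q
... | false | false = 0 , z≤n , refl , refl
... | false | true  = 1 , s≤s z≤n , refl , refl
... | true  | true  = 3 , s≤s (s≤s (s≤s z≤n)) , refl , refl
... | true  | false = 6 , ≤-refl , refl , refl

small-q-with-r⊕odd-and-next-r : ∀ q → Σ ℕ λ q′ → q′ ≤ 5 × r q xor odd q ≡ r q′ xor odd q′ × r (suc q) ≡ r (suc q′)
small-q-with-r⊕odd-and-next-r q with r q xor odd q | r (suc q)
... | false | false = 0 , z≤n , refl , refl
... | true  | false = 1 , s≤s z≤n , refl , refl
... | false | true  = 2 , s≤s (s≤s z≤n) , refl , refl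
... | true  | true  = 5 , ≤-refl , refl , refl

module _ {u : ℕ → Bool} (blockwise : Blockwise u) (t : ℕ) where

  private
    h P : ℕ
    h = 2 ^ t
    P = 2 ^ suc t

    instance
      h≢0 : NonZero h
      h≢0 = m^n≢0 2 t

    P≡h+h : P ≡ h + h
    P≡h+h = cong (h +_) (+-identityʳ h)

    h<P : h < P
    h<P = subst (h <_) (sym P≡h+h) (m<m+n h (m^n>0 2 t))

    ≤h+1⇒≤1+h : ∀ {L} → L ≤ h + 1 → L ≤ 1 + h
    ≤h+1⇒≤1+h L≤h+1 = ≤-trans L≤h+1 (≤-reflexive (+-comm h 1))

    swap : ∀ j q m → j + q * P + m ≡ j + m + q * P
    swap j q m = xy∙z≈xz∙y j (q * P) m

  blocks-agree : ∀ q q′ {j} → r q ≡ r q′ → odd q ≡ odd q′ → j < P → u (j + q * P) ≡ u (j + q′ * P)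
  blocks-agree q q′ {j} r≡ odd≡ j<P = begin
    u (j + q * P)                            ≡⟨ blockwise t q j j<P ⟩
    (r q xor (odd q ∧ high t j)) xor u j     ≡⟨ cong₂ (λ a b → (a xor (b ∧ high t j)) xor u j) r≡ odd≡ ⟩
    (r q′ xor (odd q′ ∧ high t j)) xor u j   ≡⟨ blockwise t q′ j j<P ⟨
    u (j + q′ * P)                           ∎

  low-halves-agree : ∀ q q′ {j} → r q ≡ r q′ → j < h → u (j + q * P) ≡ u (j + q′ * P)
  low-halves-agree q q′ {j} r≡ j<h = begin
    u (j + q * P)                            ≡⟨ low q ⟩
    r q xor u j                              ≡⟨ cong (_xor u j) r≡ ⟩
    r q′ xor u j                             ≡⟨ low q′ ⟨
    u (j + q′ * P)                           ∎
    where
    low : ∀ q → u (j + q * P) ≡ r q xor u j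
    low q = begin
      u (j + q * P)                          ≡⟨ blockwise t q j (<-trans j<h h<P) ⟩
      (r q xor (odd q ∧ high t j)) xor u j   ≡⟨ cong (λ b → (r q xor (odd q ∧ b)) xor u j) (dec-false (h ≤? j) (<⇒≱ j<h)) ⟩
      (r q xor (odd q ∧ false)) xor u j      ≡⟨ cong (λ b → (r q xor b) xor u j) (∧-zeroʳ (odd q)) ⟩
      (r q xor false) xor u j                ≡⟨ cong (_xor u j) (xor-identityʳ (r q)) ⟩
      r q xor u j                            ∎

  high-halves-agree : ∀ q q′ {j} → r q xor odd q ≡ r q′ xor odd q′ → h ≤ j → j < P →
    u (j + q * P) ≡ u (j + q′ * P)
  high-halves-agree q q′ {j} r⊕odd≡ h≤j j<P = begin
    u (j + q * P)                            ≡⟨ high-half q ⟩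
    (r q xor odd q) xor u j                  ≡⟨ cong (_xor u j) r⊕odd≡ ⟩
    (r q′ xor odd q′) xor u j                ≡⟨ high-half q′ ⟨
    u (j + q′ * P)                           ∎
    where
    high-half : ∀ q → u (j + q * P) ≡ (r q xor odd q) xor u j
    high-half q = begin
      u (j + q * P)                          ≡⟨ blockwise t q j j<P ⟩
      (r q xor (odd q ∧ high t j)) xor u j   ≡⟨ cong (λ b → (r q xor (odd q ∧ b)) xor u j) (dec-true (h ≤? j) h≤j) ⟩
      (r q xor (odd q ∧ true)) xor u j       ≡⟨ cong (λ b → (r q xor b) xor u j) (∧-identityʳ (odd q)) ⟩
      (r q xor odd q) xor u j                ∎

  occurrence-inside-block : ∀ {w} q {j} → j + length w ≤ P → OccursAt u w (j + q * P) →
    Σ ℕ λ q′ → q′ ≤ 6 × OccursAt u w (j + q′ * P)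
  occurrence-inside-block {w} q {j} j+L≤P occ with small-q-with-r-and-odd q
  ... | q′ , q′≤6 , r≡ , odd≡ = q′ , q′≤6 , occursAt-transfer u w occ agree
    where
    agree : ∀ m → m < length w → u (j + q * P + m) ≡ u (j + q′ * P + m)
    agree m m<L = begin
      u (j + q * P + m)                      ≡⟨ cong u (swap j q m) ⟩
      u (j + m + q * P)                      ≡⟨ blocks-agree q q′ r≡ odd≡ (<-≤-trans (+-monoʳ-< j m<L) j+L≤P) ⟩
      u (j + m + q′ * P)                     ≡⟨ cong u (swap j q′ m) ⟨
      u (j + q′ * P + m)                     ∎

  occurrence-across-blocks : ∀ {w} q {j} → h ≤ j → j < P → length w ≤ h + 1 → OccursAt u w (j + q * P) →
    Σ ℕ λ q′ → q′ ≤ 5 × OccursAt u w (j + q′ * P)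
  occurrence-across-blocks {w} q {j} h≤j j<P L≤h+1 occ with small-q-with-r⊕odd-and-next-r q
  ... | q′ , q′≤5 , r⊕odd≡ , next-r≡ = q′ , q′≤5 , occursAt-transfer u w occ agree
    where
    next-block : ∀ q m → P ≤ j + m → j + q * P + m ≡ (j + m ∸ P) + suc q * P
    next-block q m P≤j+m = begin
      j + q * P + m                          ≡⟨ swap j q m ⟩
      j + m + q * P                          ≡⟨ cong (_+ q * P) (m∸n+n≡m P≤j+m) ⟨
      (j + m ∸ P) + P + q * P                ≡⟨ +-assoc (j + m ∸ P) P (q * P) ⟩
      (j + m ∸ P) + suc q * P                ∎
    agree : ∀ m → m < length w → u (j + q * P + m) ≡ u (j + q′ * P + m)
    agree m m<L with j + m <? P
    ... | yes j+m<P = begin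
      u (j + q * P + m)                      ≡⟨ cong u (swap j q m) ⟩
      u (j + m + q * P)                      ≡⟨ high-halves-agree q q′ r⊕odd≡ (≤-trans h≤j (m≤m+n j m)) j+m<P ⟩
      u (j + m + q′ * P)                     ≡⟨ cong u (swap j q′ m) ⟨
      u (j + q′ * P + m)                     ∎
    ... | no j+m≮P = begin
      u (j + q * P + m)                      ≡⟨ cong u (next-block q m P≤j+m) ⟩
      u (j + m ∸ P + suc q * P)              ≡⟨ low-halves-agree (suc q) (suc q′) next-r≡ (m<n+o⇒m∸n<o (j + m) P j+m<P+h) ⟩
      u (j + m ∸ P + suc q′ * P)             ≡⟨ cong u (next-block q′ m P≤j+m) ⟨
      u (j + q′ * P + m)                     ∎
      where
      P≤j+m : P ≤ j + m
      P≤j+m = ≮⇒≥ j+m≮P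
      j+m<P+h : j + m < P + h
      j+m<P+h = +-mono-<-≤ j<P (s≤s⁻¹ (≤-trans m<L (≤h+1⇒≤1+h L≤h+1)))

  window-bound : ∀ a {j L q′} → j + L ≤ a * P → a + q′ ≤ 7 → j + q′ * P + L ≤ 7 * P
  window-bound a {j} {L} {q′} j+L≤aP a+q′≤7 =
    ≤-trans (≤-reflexive (swap j q′ L))
      (≤-trans (+-monoˡ-≤ (q′ * P) j+L≤aP)
        (subst (_≤ 7 * P) (*-distribʳ-+ P a q′) (*-monoˡ-≤ P a+q′≤7)))

  occurrence-in-first-seven-blocks : ∀ {w} q {j} → j < P → length w ≤ h + 1 → OccursAt u w (j + q * P) →
    Σ ℕ λ q′ → j + q′ * P + length w ≤ 7 * P × OccursAt u w (j + q′ * P)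
  occurrence-in-first-seven-blocks {w} q {j} j<P L≤h+1 occ with h ≤? j
  ... | no j≱h =
    let q′ , q′≤6 , occ′ = occurrence-inside-block {w} q j+L≤P occ
    in  q′ , window-bound 1 {j} (≤-trans j+L≤P (m≤m+n P 0)) (s≤s q′≤6) , occ′
    where
    j+L≤P : j + length w ≤ P
    j+L≤P = subst (j + length w ≤_) (sym P≡h+h)
      (s≤s⁻¹ (subst (j + length w <_) (+-suc h h) (+-mono-<-≤ (≰⇒> j≱h) (≤h+1⇒≤1+h L≤h+1))))
  ... | yes h≤j =
    let q′ , q′≤5 , occ′ = occurrence-across-blocks {w} q h≤j j<P L≤h+1 occ
    in  q′ , window-bound 2 {j} (<⇒≤ (+-mono-<-≤ j<P L≤P+0)) (s≤s (s≤s q′≤5)) , occ′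
    where
    L≤P+0 : length w ≤ P + 0
    L≤P+0 = ≤-trans (≤h+1⇒≤1+h L≤h+1) (≤-trans h<P (m≤m+n P 0))

blockwise : ∀ {u} → (u ≡ r) ⊎ (u ≡ s) → Blockwise u
blockwise (inj₁ refl) = r-blockwise
blockwise (inj₂ refl) = s-blockwise

lemma4p3 : (u : ℕ → Bool) → (u ≡ r) ⊎ (u ≡ s) → (t : ℕ) → 1 ≤ t →
    (w : List Bool) → length w ≤ 2 ^ t + 1 → (i : ℕ) → OccursAt u w i →
    Σ ℕ (λ k → (k + length w ≤ 7 * 2 ^ (t + 1)) × (k ≡ i [mod2^ (t + 1) ]) × OccursAt u w k)
lemma4p3 u u∈rs t _ w L≤h+1 i occ rewrite +-comm t 1 =
  let q′ , bound , occ′ = occurrence-in-first-seven-blocks (blockwise u∈rs) t {w} (i / P) (m%n<n i P) L≤h+1 occ-i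
  in  i % P + q′ * P , bound , same-residue q′ , occ′
  where
  P = 2 ^ suc t
  instance
    P≢0 : NonZero P
    P≢0 = m^n≢0 2 (suc t)
  occ-i : OccursAt u w (i % P + i / P * P)
  occ-i = subst (OccursAt u w) (m≡m%n+[m/n]*n i P) occ
  same-residue : ∀ q′ → (i % P + q′ * P) % P ≡ i % P
  same-residue q′ = trans ([m+kn]%n≡m%n (i % P) q′ P) (m%n%n≡m%n i P)
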